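{- Let $t$ be the transduction described in the context, let $\mathcal L=\{abu:u\in\{a,b\}^*\}\cup\{\epsilon,a\}$, and for a finite word $u\in\{a,b\}^*$ let $h(u)=\big||u|_a-|u|_b\big|$, where $|u|_x$ is the number of occurrences of the letter $x$ in $u$. Then for every $v\in\mathcal L$, $$h(t(v))\le \frac{h(v)}{4}+1.$$
   Context: The deterministic transducer has states $00,10,20,11,12,21,22$ with initial state $00$. Its transitions, written "state --input|output--> new state" with $\epsilon$ the empty word, are: - $00$ --$a|\epsilon$--> $10$; $00$ --$b|\epsilon$--> $11$; - $10$ --$a|\epsilon$--> $20$; $10$ --$b|\epsilon$--> $21$; - $20$ --$a|\epsilon$--> $11$; $20$ --$b|\epsilon$--> $12$; - $11$ --$a|\epsilon$--> $21$; $11$ --$b|\epsilon$--> $22$; - $21$ --$a|a$--> $12$; $21$ --$b|ab$--> $11$; - $12$ --$a|\epsilon$--> $22$; $12$ --$b|b$--> $21$; - $22$ --$a|ba$--> $11$; $22$ --$b|ba$--> $12$. For $u\in\{a,b\}^*$, $t(u)$ is the concatenation of the outputs along the path starting at $00$ and reading $u$. -}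

module Defs where

open import Data.Nat using (ℕ; zero; suc; ∣_-_∣)

open import Data.List using (List; []; _∷_; _++_)
open import Data.Product using (_×_; _,_; proj₁; proj₂; ∃-syntax)
open import Data.Sum using (_⊎_)
open import Relation.Binary.PropositionalEquality using (_≡_)

data Letter : Set where
  a b : Letter

Word : Set
Word = List Letter

data State : Set where
  s00 s10 s20 s11 s12 s21 s22 : State

step : State → Letter → State × Word
step s00 a = s10 , []
step s00 b = s11 , []
step s10 a = s20 , []
step s10 b = s21 , []
step s20 a = s11 , []
step s20 b = s12 , []
step s11 a = s21 , []
step s11 b = s22 , []
step s21 a = s12 , a ∷ []
step s21 b = s11 , a ∷ b ∷ []
step s12 a = s22 , []
step s12 b = s21 , b ∷ []
step s22 a = s11 , b ∷ a ∷ []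
step s22 b = s12 , b ∷ a ∷ []

run : State → Word → Word
run q [] = []
run q (x ∷ u) = proj₂ (step q x) ++ run (proj₁ (step q x)) u

t : Word → Word
t = run s00

countA : Word → ℕ
countA [] = 0
countA (a ∷ u) = suc (countA u)
countA (b ∷ u) = countA u

countB : Word → ℕ
countB [] = 0
countB (a ∷ u) = countB u
countB (b ∷ u) = suc (countB u)

h : Word → ℕ
h u = ∣ countA u - countB u ∣

InL : Word → Set
InL v = (∃[ u ] v ≡ a ∷ b ∷ u) ⊎ (v ≡ []) ⊎ (v ≡ a ∷ [])

module Submission where

-- After the prefix ab the transducer sits in state 21 and has
-- produced no output; from then on it stays in the cycle {11,12,21,22}.  Measure a
-- word w by its balance bal(w) = |w|_a - |w|_b ∈ ℤ, so that h(w) = |bal(w)|.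
-- On the cycle there is a potential φ (φ 21 = 0, φ 11 = 1, φ 22 = 2, φ 12 = 3)
-- such that every transition q --x|o--> q' satisfies
--     φ q + 4·bal(o) = bal(x) + φ q'.
-- Summing along a run from state 21 gives 4·bal(t(ab u)) = bal(u) + φ(final),
-- hence 4·h(t(ab u)) ≤ h(u) + 3 ≤ h(ab u) + 4, since 0 ≤ φ ≤ 3 and ab is
-- balanced.  The words ε and a have empty output.

open import Defs
open import Data.Rational using (ℚ; _≤_; _+_; _/_; 1ℚ)
open import Data.Integer using (+_)

open import Data.Nat as ℕ using (ℕ; zero; suc; ∣_-_∣)
import Data.Nat.Properties as ℕP
open import Data.Integer as ℤ using (ℤ; _⊖_)
import Data.Integer.Properties as ℤP
open import Data.Integer.Tactic.RingSolver using (solve-∀)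
open import Data.Rational using (toℚᵘ)
open import Data.Rational.Properties using (toℚᵘ-cancel-≤; toℚᵘ-fromℚᵘ; toℚᵘ-homo-+)
import Data.Rational.Unnormalised as ℚᵘ
import Data.Rational.Unnormalised.Properties as ℚᵘP
open import Data.List using ([]; _∷_; _++_)
open import Data.Product using (_×_; _,_; proj₁; proj₂)
open import Data.Sum using (inj₁; inj₂)
open import Relation.Binary.PropositionalEquality

∣⊖∣≡∣-∣ : ∀ m n → ℤ.∣ m ⊖ n ∣ ≡ ∣ m - n ∣
∣⊖∣≡∣-∣ zero    zero    = refl
∣⊖∣≡∣-∣ zero    (suc n) = refl
∣⊖∣≡∣-∣ (suc m) zero    = refl
∣⊖∣≡∣-∣ (suc m) (suc n) =
  trans (cong ℤ.∣_∣ (ℤP.[1+m]⊖[1+n]≡m⊖n m n)) (∣⊖∣≡∣-∣ m n)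

bal : Word → ℤ
bal w = + countA w ℤ.- + countB w

h≡∣bal∣ : ∀ w → h w ≡ ℤ.∣ bal w ∣
h≡∣bal∣ w = sym (trans (cong ℤ.∣_∣ (ℤP.m-n≡m⊖n (countA w) (countB w)))
                       (∣⊖∣≡∣-∣ (countA w) (countB w)))

countA-++ : ∀ xs ys → countA (xs ++ ys) ≡ countA xs ℕ.+ countA ys
countA-++ []       ys = refl
countA-++ (a ∷ xs) ys = cong suc (countA-++ xs ys)
countA-++ (b ∷ xs) ys = countA-++ xs ys

countB-++ : ∀ xs ys → countB (xs ++ ys) ≡ countB xs ℕ.+ countB ys
countB-++ []       ys = refl
countB-++ (a ∷ xs) ys = countB-++ xs ys
countB-++ (b ∷ xs) ys = cong suc (countB-++ xs ys)

bal-++ : ∀ xs ys → bal (xs ++ ys) ≡ bal xs ℤ.+ bal ys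
bal-++ xs ys = begin
  + countA (xs ++ ys) ℤ.- + countB (xs ++ ys)
    ≡⟨ cong₂ (λ m n → + m ℤ.- + n) (countA-++ xs ys) (countB-++ xs ys) ⟩
  + (countA xs ℕ.+ countA ys) ℤ.- + (countB xs ℕ.+ countB ys)
    ≡⟨ cong₂ ℤ._-_ (ℤP.pos-+ (countA xs) (countA ys)) (ℤP.pos-+ (countB xs) (countB ys)) ⟩
  (+ countA xs ℤ.+ + countA ys) ℤ.- (+ countB xs ℤ.+ + countB ys)
    ≡⟨ regroup (+ countA xs) (+ countA ys) (+ countB xs) (+ countB ys) ⟩
  bal xs ℤ.+ bal ys ∎
  where
  open ≡-Reasoning
  regroup : ∀ p q r s → (p ℤ.+ q) ℤ.- (r ℤ.+ s) ≡ (p ℤ.- r) ℤ.+ (q ℤ.- s)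
  regroup = solve-∀

next : State → Letter → State
next q x = proj₁ (step q x)

out : State → Letter → Word
out q x = proj₂ (step q x)

final : State → Word → State
final q []      = q
final q (x ∷ u) = final (next q x) u

-- The strongly connected part of the transducer, entered after reading ab.
data Cyclic : State → Set where
  c11 : Cyclic s11
  c12 : Cyclic s12
  c21 : Cyclic s21
  c22 : Cyclic s22

-- The potential: balance read but not yet emitted, scaled by 4.
φ : State → ℕ
φ s21 = 0
φ s11 = 1
φ s22 = 2
φ s12 = 3
φ _   = 0

φ≤3 : ∀ q → φ q ℕ.≤ 3
φ≤3 s00 = ℕ.z≤n
φ≤3 s10 = ℕ.z≤n
φ≤3 s20 = ℕ.z≤n
φ≤3 s11 = ℕ.s≤s ℕ.z≤n
φ≤3 s12 = ℕP.≤-refl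
φ≤3 s21 = ℕ.z≤n
φ≤3 s22 = ℕ.s≤s (ℕ.s≤s ℕ.z≤n)

Balanced : State → Letter → Set
Balanced q x = + φ q ℤ.+ + 4 ℤ.* bal (out q x) ≡ bal (x ∷ []) ℤ.+ + φ (next q x)

cyclic-step : ∀ {q} → Cyclic q → ∀ x → Cyclic (next q x) × Balanced q x
cyclic-step c11 a = c21 , refl
cyclic-step c11 b = c22 , refl
cyclic-step c12 a = c22 , refl
cyclic-step c12 b = c21 , refl
cyclic-step c21 a = c12 , refl
cyclic-step c21 b = c11 , refl
cyclic-step c22 a = c11 , refl
cyclic-step c22 b = c12 , refl

run-invariant : ∀ {q} → Cyclic q → ∀ u →
  + φ q ℤ.+ + 4 ℤ.* bal (run q u) ≡ bal u ℤ.+ + φ (final q u)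
run-invariant {q} c [] = ℤP.+-comm (+ φ q) (+ 0)
run-invariant {q} c (x ∷ u) = begin
  + φ q ℤ.+ + 4 ℤ.* bal (o ++ run q' u)
    ≡⟨ cong (λ z → + φ q ℤ.+ + 4 ℤ.* z) (bal-++ o (run q' u)) ⟩
  + φ q ℤ.+ + 4 ℤ.* (bal o ℤ.+ bal (run q' u))
    ≡⟨ split (+ φ q) (bal o) (bal (run q' u)) ⟩
  (+ φ q ℤ.+ + 4 ℤ.* bal o) ℤ.+ + 4 ℤ.* bal (run q' u)
    ≡⟨ cong (ℤ._+ + 4 ℤ.* bal (run q' u)) balanced ⟩
  (bal (x ∷ []) ℤ.+ + φ q') ℤ.+ + 4 ℤ.* bal (run q' u)
    ≡⟨ ℤP.+-assoc (bal (x ∷ [])) (+ φ q') _ ⟩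
  bal (x ∷ []) ℤ.+ (+ φ q' ℤ.+ + 4 ℤ.* bal (run q' u))
    ≡⟨ cong (λ z → bal (x ∷ []) ℤ.+ z) (run-invariant c' u) ⟩
  bal (x ∷ []) ℤ.+ (bal u ℤ.+ + φ (final q' u))
    ≡⟨ ℤP.+-assoc (bal (x ∷ [])) (bal u) _ ⟨
  (bal (x ∷ []) ℤ.+ bal u) ℤ.+ + φ (final q' u)
    ≡⟨ cong (ℤ._+ + φ (final q' u)) (bal-++ (x ∷ []) u) ⟨
  bal (x ∷ u) ℤ.+ + φ (final q' u) ∎
  where
  open ≡-Reasoning
  q' = next q x
  o  = out q x
  c' = proj₁ (cyclic-step c x)
  balanced = proj₂ (cyclic-step c x)
  split : ∀ p r s → p ℤ.+ + 4 ℤ.* (r ℤ.+ s) ≡ (p ℤ.+ + 4 ℤ.* r) ℤ.+ + 4 ℤ.* s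
  split = solve-∀

scaled-abs-bound : ∀ c k x y → + c ℤ.* y ≡ x ℤ.+ + k → c ℕ.* ℤ.∣ y ∣ ℕ.≤ ℤ.∣ x ∣ ℕ.+ k
scaled-abs-bound c k x y eq = begin
  c ℕ.* ℤ.∣ y ∣      ≡⟨ ℤP.∣i*j∣≡∣i∣*∣j∣ (+ c) y ⟨
  ℤ.∣ + c ℤ.* y ∣    ≡⟨ cong ℤ.∣_∣ eq ⟩
  ℤ.∣ x ℤ.+ + k ∣    ≤⟨ ℤP.∣i+j∣≤∣i∣+∣j∣ x (+ k) ⟩
  ℤ.∣ x ∣ ℕ.+ k      ∎
  where open ℕP.≤-Reasoning

run21-bound : ∀ u → 4 ℕ.* h (run s21 u) ℕ.≤ h u ℕ.+ 3
run21-bound u = begin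
  4 ℕ.* h (run s21 u)                   ≡⟨ cong (4 ℕ.*_) (h≡∣bal∣ (run s21 u)) ⟩
  4 ℕ.* ℤ.∣ bal (run s21 u) ∣           ≤⟨ scaled-abs-bound 4 k (bal u) (bal (run s21 u)) invariant ⟩
  ℤ.∣ bal u ∣ ℕ.+ k                     ≤⟨ ℕP.+-monoʳ-≤ ℤ.∣ bal u ∣ (φ≤3 (final s21 u)) ⟩
  ℤ.∣ bal u ∣ ℕ.+ 3                     ≡⟨ cong (ℕ._+ 3) (h≡∣bal∣ u) ⟨
  h u ℕ.+ 3                             ∎
  where
  open ℕP.≤-Reasoning
  k = φ (final s21 u)
  invariant : + 4 ℤ.* bal (run s21 u) ≡ bal u ℤ.+ + k
  invariant = trans (sym (ℤP.+-identityˡ _)) (run-invariant c21 u)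

-- The bound 4·h(t v) ≤ h(v) + 4 on the language L.  Reading ab leads to
-- state 21 with empty output and does not change h.
L-bound : ∀ v → InL v → 4 ℕ.* h (t v) ℕ.≤ h v ℕ.+ 4
L-bound _ (inj₁ (u , refl))  = ℕP.≤-trans (run21-bound u) (ℕP.+-monoʳ-≤ (h u) (ℕP.n≤1+n 3))
L-bound _ (inj₂ (inj₁ refl)) = ℕ.z≤n
L-bound _ (inj₂ (inj₂ refl)) = ℕ.z≤n

-- The cross-multiplied form of n/1 ≤ m/4 + 1, as an integer inequality.
cross-multiplied : ∀ n m → 4 ℕ.* n ℕ.≤ m ℕ.+ 4 →
  + n ℤ.* + 4 ℤ.≤ (+ m ℤ.* + 1 ℤ.+ + 1 ℤ.* + 4) ℤ.* + 1
cross-multiplied n m le = begin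
  + n ℤ.* + 4                            ≡⟨ ℤP.*-comm (+ n) (+ 4) ⟩
  + 4 ℤ.* + n                            ≡⟨ ℤP.pos-* 4 n ⟨
  + (4 ℕ.* n)                            ≤⟨ ℤ.+≤+ le ⟩
  + (m ℕ.+ 4)                            ≡⟨ ℤP.pos-+ m 4 ⟩
  + m ℤ.+ + 4                            ≡⟨ unfold (+ m) ⟩
  (+ m ℤ.* + 1 ℤ.+ + 1 ℤ.* + 4) ℤ.* + 1  ∎
  where
  open ℤP.≤-Reasoning
  unfold : ∀ i → i ℤ.+ + 4 ≡ (i ℤ.* + 1 ℤ.+ + 1 ℤ.* + 4) ℤ.* + 1
  unfold = solve-∀

quarter-bound : ∀ n m → 4 ℕ.* n ℕ.≤ m ℕ.+ 4 → (+ n) / 1 ≤ ((+ m) / 4) + 1ℚ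
quarter-bound n m le = toℚᵘ-cancel-≤ (begin
  toℚᵘ ((+ n) / 1)               ≃⟨ toℚᵘ-fromℚᵘ (ℚᵘ.mkℚᵘ (+ n) 0) ⟩
  ℚᵘ.mkℚᵘ (+ n) 0                ≤⟨ ℚᵘ.*≤* (cross-multiplied n m le) ⟩
  ℚᵘ.mkℚᵘ (+ m) 3 ℚᵘ.+ ℚᵘ.1ℚᵘ     ≃⟨ ℚᵘP.+-congˡ ℚᵘ.1ℚᵘ (toℚᵘ-fromℚᵘ (ℚᵘ.mkℚᵘ (+ m) 3)) ⟨
  toℚᵘ ((+ m) / 4) ℚᵘ.+ ℚᵘ.1ℚᵘ   ≃⟨ toℚᵘ-homo-+ ((+ m) / 4) 1ℚ ⟨
  toℚᵘ (((+ m) / 4) + 1ℚ)        ∎)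
  where open ℚᵘP.≤-Reasoning

lemma5 : (v : Word) → InL v → (+ h (t v)) / 1 ≤ ((+ h v) / 4) + 1ℚ
lemma5 v v∈L = quarter-bound (h (t v)) (h v) (L-bound v v∈L)
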